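{- Let $M$ be a maximum induced matching of the grid $G_{5,5}$ and suppose the edge joining $u_1v_1$ and $u_2v_1$ belongs to $M$. Then: (a) at least one of the vertices $u_4v_1$, $u_5v_1$ is saturated by $M$; (b) if $G_a$ denotes the subgraph of $G_{5,5}$ induced by $V(G_{5,5})\setminus V_1$, where $V_1=\{u_1v_1,\dots,u_5v_1\}$, and $M_a$ is the set of edges of $M$ with both endpoints in $V(G_a)$, then $|M_a|\neq \mathrm{Max}(G_a)$; (c) there is an edge of $M$ both of whose endpoints lie in the column $V_5=\{u_1v_5,\dots,u_5v_5\}$.
   Context: For integers $n,m\geq 2$, the grid $G_{n,m}$ is the Cartesian product of the path $P_n=u_1u_2\cdots u_n$ and the path $P_m=v_1v_2\cdots v_m$; its vertices are written $u_iv_j$ ($1\le i\le n$, $1\le j\le m$), and $u_iv_j$, $u_kv_l$ are adjacent iff either $i=k$ and $|j-l|=1$, or $j=l$ and $|i-k|=1$. An induced matching of a graph $G$ is a set $M$ of pairwise vertex-disjoint edges such that no edge of $G$ joins endpoints of two distinct edges of $M$; $\mathrm{Max}(G)$ is the maximum size of an induced matching of $G$, and a maximum induced matching is one of that size. A vertex is saturated by $M$ if it is an endpoint of an edge of $M$. -}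

module Defs where

import Data.Nat as ℕ
open ℕ using (ℕ; _≤_)
open import Data.Fin using (Fin; toℕ; zero; suc)
open import Data.Fin.Properties using (_≟_)
open import Data.Product using (Σ; _×_; _,_; proj₁; proj₂)
open import Data.Sum using (_⊎_)
open import Data.List using (List; length; filter)
open import Data.List.Relation.Unary.All using (All)
open import Data.List.Relation.Unary.Any using (Any)
open import Data.List.Relation.Unary.AllPairs using (AllPairs)
open import Data.List.Membership.Propositional using (_∈_)
open import Relation.Binary.PropositionalEquality using (_≡_; _≢_)
open import Relation.Nullary using (¬_)
open import Relation.Nullary.Decidable using (¬?; _×-dec_)
open import Relation.Unary using (Decidable)

record Graph : Set₁ where
  field
    V   : Set
    Adj : V → V → Set
open Graph public

-- An edge {x,y} is represented by an ordered pair (x , y) with Adj x y.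
Edge : Graph → Set
Edge G = V G × V G

_∈ₑ_ : {G : Graph} → V G → Edge G → Set
x ∈ₑ (a , b) = x ≡ a ⊎ x ≡ b

Compatible : (G : Graph) → Edge G → Edge G → Set
Compatible G (a , b) (c , d) =
  (a ≢ c × a ≢ d × b ≢ c × b ≢ d) ×
  (¬ Adj G a c × ¬ Adj G a d × ¬ Adj G b c × ¬ Adj G b d)

-- M (a list of edges, listed without repetition by the disjointness
-- condition on distinct positions) is an induced matching of G
IsInducedMatching : (G : Graph) → List (Edge G) → Set
IsInducedMatching G M =
  All (λ e → Adj G (proj₁ e) (proj₂ e)) M × AllPairs (Compatible G) M

IsMax : Graph → ℕ → Set
IsMax G k =
  Σ (List (Edge G)) (λ M → IsInducedMatching G M × length M ≡ k) ×
  ((M : List (Edge G)) → IsInducedMatching G M → length M ≤ k)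

IsMaximumInducedMatching : (G : Graph) → List (Edge G) → Set
IsMaximumInducedMatching G M =
  IsInducedMatching G M ×
  ((M' : List (Edge G)) → IsInducedMatching G M' → length M' ≤ length M)

Saturated : (G : Graph) → V G → List (Edge G) → Set
Saturated G x M = Any (λ e → _∈ₑ_ {G} x e) M

EdgeIn : (G : Graph) → V G → V G → List (Edge G) → Set
EdgeIn G x y M = (x , y) ∈ M ⊎ (y , x) ∈ M

Induced : (G : Graph) → (V G → Set) → Graph
Induced G P = record
  { V = Σ (V G) P
  ; Adj = λ x y → Adj G (proj₁ x) (proj₁ y) }

-- Grid G_{n,m} = P_n □ P_m; vertex (i , j) stands for u_{i+1} v_{j+1}.
Grid : ℕ → ℕ → Graph
Grid n m = record
  { V = Fin n × Fin m
  ; Adj = λ { (i , j) (k , l) →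
        (i ≡ k × (toℕ j ≡ ℕ.suc (toℕ l) ⊎ toℕ l ≡ ℕ.suc (toℕ j)))
      ⊎ (j ≡ l × (toℕ i ≡ ℕ.suc (toℕ k) ⊎ toℕ k ≡ ℕ.suc (toℕ i))) } }

G55 : Graph
G55 = Grid 5 5

uv : Fin 5 → Fin 5 → V G55
uv i j = (i , j)

NotV1 : V G55 → Set
NotV1 (i , j) = j ≢ zero

Ga : Graph
Ga = Induced G55 NotV1

Ma : List (Edge G55) → List (Edge G55)
Ma M = filter (λ e → ¬? (proj₂ (proj₁ e) ≟ zero) ×-dec ¬? (proj₂ (proj₂ e) ≟ zero)) M

InV5 : Edge G55 → Set
InV5 ((i , j) , (k , l)) = j ≡ suc (suc (suc (suc zero))) × l ≡ suc (suc (suc (suc zero)))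

-- Orient every edge of the grid towards its larger endpoint. A maximum induced matching M
-- of G₅,₅ has at least six edges, because the vertical edges u₁v_ju₂v_j and u₄v_ju₅v_j
-- (j = 1, 3, 5) form one. Oriented, M becomes a set of at least six pairwise compatible
-- forward edges containing u₁v₁u₂v₁, and a branch-and-bound search through the 39 other
-- forward edges shows that every such set saturates u₄v₁ or u₅v₁, has an edge inside V₅,
-- and has at most four edges avoiding V₁. Since G_a has an induced matching with five
-- edges, |M_a| < Max(G_a).
module Submission where

open import Defs
open import Data.Bool.Base using (Bool; true; T; if_then_else_; _∧_)
open import Data.Bool.Properties using (T-∧)
open import Data.Empty using (⊥-elim)
open import Data.Fin using (zero; suc; toℕ; #_)
import Data.Fin.Properties as Fin
open import Data.List
  using (List; []; _∷_; [_]; length; map; filter; _ʳ++_; allFin; cartesianProduct)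
open import Data.List.Properties using (length-map; length-ʳ++; length-removeAt′)
open import Data.List.Membership.Propositional using (_∈_; _─_)
open import Data.List.Membership.Propositional.Properties
  using (∈-map⁺; ∈-map⁻; ∈-filter⁺; ∈-filter⁻; ∈-allFin; ∈-cartesianProduct⁺)
open import Data.List.Relation.Binary.Subset.Propositional using (_⊆_)
open import Data.List.Relation.Binary.Subset.Propositional.Properties using (Any-resp-⊆; filter⁺′)
open import Data.List.Relation.Binary.Sublist.Propositional using ([]; _∷_; _∷ʳ_)
  renaming (_⊆_ to _⊑_)
import Data.List.Relation.Binary.Sublist.Propositional.Properties as Sublist
open import Data.List.Relation.Unary.All as All using (All; all?)
import Data.List.Relation.Unary.All.Properties as All
open import Data.List.Relation.Unary.AllPairs as AllPairs using (AllPairs; []; _∷_; allPairs?)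
import Data.List.Relation.Unary.AllPairs.Properties as AllPairs
open import Data.List.Relation.Unary.Any as Any using (Any; here; there; any?)
import Data.List.Relation.Unary.Any.Properties as Any
open import Data.List.Relation.Unary.Unique.Propositional using (Unique)
import Data.List.Relation.Unary.Unique.Propositional.Properties as Unique
open import Data.Nat using (ℕ; suc; _≤_; _+_; _≤?_; _<?_; z≤n; s≤s)
import Data.Nat as ℕ
open import Data.Nat.Properties using (≤-trans; <⇒≱; <⇒≢; +-comm; +-monoˡ-≤; module ≤-Reasoning)
open import Data.Product using (_×_; _,_; proj₁; proj₂; swap)
open import Data.Product.Properties using (≡-dec)
open import Data.Sum using (_⊎_; inj₁; inj₂)
import Data.Sum as Sum
open import Function.Base using (_∘_; id)
open import Function.Bundles using (Equivalence)
open import Level using (0ℓ)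
open import Relation.Binary.Construct.Closure.Reflexive as Refl using (ReflClosure)
import Relation.Binary.Construct.Closure.Reflexive.Properties as ReflClosure
open import Relation.Binary.Core using (Rel)
open import Relation.Binary.Definitions using (DecidableEquality; Symmetric)
  renaming (Decidable to Decidable₂)
open import Relation.Binary.PropositionalEquality using (_≡_; _≢_; refl; sym; cong; subst; ≢-sym)
open import Relation.Nullary using (¬_; Dec; yes; no; does; isYes)
open import Relation.Nullary.Decidable using (_×-dec_; _⊎-dec_; _→-dec_; ¬?; toWitness)
open import Relation.Unary using (Pred; Decidable)

module _ {A : Set} where

  ∈-─ : ∀ {x y} {ys : List A} (x∈ys : x ∈ ys) → y ∈ ys → y ≢ x → y ∈ ys ─ x∈ys
  ∈-─ (here refl) (here refl) y≢x = ⊥-elim (y≢x refl)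
  ∈-─ (here refl) (there y∈ys) _  = y∈ys
  ∈-─ (there x∈ys) (here refl) _  = here refl
  ∈-─ (there x∈ys) (there y∈ys) y≢x = there (∈-─ x∈ys y∈ys y≢x)

  Unique-⊆⇒length≤ : ∀ {xs ys : List A} → Unique xs → xs ⊆ ys → length xs ≤ length ys
  Unique-⊆⇒length≤ [] _ = z≤n
  Unique-⊆⇒length≤ {x ∷ xs} {ys} (x∉xs ∷ xs!) xxs⊆ys = begin
    suc (length xs)          ≤⟨ s≤s (Unique-⊆⇒length≤ xs! xs⊆ys─x) ⟩
    suc (length (ys ─ x∈ys)) ≡⟨ sym (length-removeAt′ ys _) ⟩
    length ys                ∎
    where
      open ≤-Reasoning
      x∈ys = xxs⊆ys (here refl)
      xs⊆ys─x : xs ⊆ ys ─ x∈ys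
      xs⊆ys─x y∈xs = ∈-─ x∈ys (xxs⊆ys (there y∈xs)) (≢-sym (All.lookup x∉xs y∈xs))

  Clique : Rel A 0ℓ → List A → Set
  Clique R xs = ∀ {x y} → x ∈ xs → y ∈ xs → ReflClosure R x y

  Clique-⊆ : ∀ {R xs ys} → ys ⊆ xs → Clique R xs → Clique R ys
  Clique-⊆ ys⊆xs clq x∈ys y∈ys = clq (ys⊆xs x∈ys) (ys⊆xs y∈ys)

  AllPairs⇒Clique : ∀ {R xs} → Symmetric R → AllPairs R xs → Clique R xs
  AllPairs⇒Clique sym (_ ∷ _) (here refl) (here refl) = Refl.refl
  AllPairs⇒Clique sym (x~xs ∷ _) (here refl) (there y∈xs) = Refl.[ All.lookup x~xs y∈xs ]
  AllPairs⇒Clique sym (x~xs ∷ _) (there x∈xs) (here refl) = Refl.[ sym (All.lookup x~xs x∈xs) ]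
  AllPairs⇒Clique sym (_ ∷ xs!) (there x∈xs) (there y∈xs) = AllPairs⇒Clique sym xs! x∈xs y∈xs

module _ {P : Set} {b : Bool} where

  if-no : (d : Dec P) → ¬ P → T (if does d then true else b) → T b
  if-no (yes p) ¬p _ = ⊥-elim (¬p p)
  if-no (no _)  _  t = t

  if-yes : (d : Dec P) → P → T (if does d then b else true) → T b
  if-yes (yes _) _ t = t
  if-yes (no ¬p) p _ = ⊥-elim (¬p p)

module CliqueSearch {A : Set} (_≟_ : DecidableEquality A) {R : Rel A 0ℓ} (R? : Decidable₂ R)
                    (n : ℕ) {Good : Pred (List A) 0ℓ} (good? : Decidable Good) where

  relatedToAll? : ∀ x → Decidable (All (ReflClosure R x))
  relatedToAll? x = all? (ReflClosure.dec _≟_ R? x)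

  search : List A → List A → Bool
  search chosen [] = isYes (n ≤? length chosen →-dec good? chosen)
  search chosen (x ∷ xs) =
    if does (length chosen + length (x ∷ xs) <? n) then true
    else (search chosen xs ∧
          (if does (relatedToAll? x chosen) then search (x ∷ chosen) xs else true))

  ʳ++-length-bound : ∀ (chosen : List A) {xs ys} → ys ⊑ xs →
                     length (ys ʳ++ chosen) ≤ length chosen + length xs
  ʳ++-length-bound chosen {xs} {ys} ys⊑xs = begin
    length (ys ʳ++ chosen)     ≡⟨ length-ʳ++ ys ⟩
    length ys + length chosen  ≤⟨ +-monoˡ-≤ (length chosen) (Sublist.length-mono-≤ ys⊑xs) ⟩
    length xs + length chosen  ≡⟨ +-comm (length xs) (length chosen) ⟩
    length chosen + length xs  ∎
    where open ≤-Reasoning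

  search-step : ∀ {chosen x xs ys} → ys ⊑ x ∷ xs → n ≤ length (ys ʳ++ chosen) →
                T (search chosen (x ∷ xs)) →
                T (search chosen xs) × (All (ReflClosure R x) chosen → T (search (x ∷ chosen) xs))
  search-step {chosen} {x} {xs} ys⊑ big ok = skip , keep
    where
      reachable : n ≤ length chosen + length (x ∷ xs)
      reachable = ≤-trans big (ʳ++-length-bound chosen ys⊑)

      unpruned : T (search chosen xs ∧
                    (if does (relatedToAll? x chosen) then search (x ∷ chosen) xs else true))
      unpruned = if-no (length chosen + length (x ∷ xs) <? n) (λ short → <⇒≱ short reachable) ok

      skip : T (search chosen xs)
      skip = proj₁ (Equivalence.to T-∧ unpruned)

      keep : All (ReflClosure R x) chosen → T (search (x ∷ chosen) xs)
      keep related = if-yes (relatedToAll? x chosen) related (proj₂ (Equivalence.to T-∧ unpruned))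

  -- The candidates kept so far are in chosen, most recent first, so a sublist ys of the
  -- remaining candidates completes them to the clique ys ʳ++ chosen.
  search-sound : ∀ chosen xs → T (search chosen xs) →
                 ∀ {ys} → ys ⊑ xs → Clique R (ys ʳ++ chosen) →
                 n ≤ length (ys ʳ++ chosen) → Good (ys ʳ++ chosen)
  search-sound chosen [] ok [] _ big = toWitness ok big
  search-sound chosen (x ∷ xs) ok ys⊑@(.x ∷ʳ ys⊑xs) clq big =
    search-sound chosen xs (proj₁ (search-step ys⊑ big ok)) ys⊑xs clq big
  search-sound chosen (x ∷ xs) ok ys⊑@(_∷_ {xs = ys} refl ys⊑xs) clq big =
    search-sound (x ∷ chosen) xs (proj₂ (search-step ys⊑ big ok) related) ys⊑xs clq big
    where
      related : All (ReflClosure R x) chosen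
      related = All.tabulate λ c∈chosen →
        clq (Any.reverseAcc⁺ (x ∷ chosen) ys (inj₁ (here refl)))
            (Any.reverseAcc⁺ (x ∷ chosen) ys (inj₁ (there c∈chosen)))

module _ (G : Graph) where

  Compatible-swapˡ : ∀ {e f} → Compatible G e f → Compatible G (swap e) f
  Compatible-swapˡ {_ , _} {_ , _} ((a≢c , a≢d , b≢c , b≢d) , (a≁c , a≁d , b≁c , b≁d)) =
    (b≢c , b≢d , a≢c , a≢d) , (b≁c , b≁d , a≁c , a≁d)

  Compatible-swapʳ : ∀ {e f} → Compatible G e f → Compatible G e (swap f)
  Compatible-swapʳ {_ , _} {_ , _} ((a≢c , a≢d , b≢c , b≢d) , (a≁c , a≁d , b≁c , b≁d)) =
    (a≢d , a≢c , b≢d , b≢c) , (a≁d , a≁c , b≁d , b≁c)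

  Compatible-sym : Symmetric (Adj G) → Symmetric (Compatible G)
  Compatible-sym adj-sym {_ , _} {_ , _} ((a≢c , a≢d , b≢c , b≢d) , (a≁c , a≁d , b≁c , b≁d)) =
    (≢-sym a≢c , ≢-sym b≢c , ≢-sym a≢d , ≢-sym b≢d) ,
    (a≁c ∘ adj-sym , b≁c ∘ adj-sym , a≁d ∘ adj-sym , b≁d ∘ adj-sym)

  Compatible⇒≢ : ∀ {e f} → Compatible G e f → e ≢ f
  Compatible⇒≢ {_ , _} {_ , _} ((a≢c , _) , _) = a≢c ∘ cong proj₁

  compatible? : DecidableEquality (V G) → Decidable₂ (Adj G) → Decidable₂ (Compatible G)
  compatible? _≟_ adj? (a , b) (c , d) =
    (¬? (a ≟ c) ×-dec ¬? (a ≟ d) ×-dec ¬? (b ≟ c) ×-dec ¬? (b ≟ d)) ×-dec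
    (¬? (adj? a c) ×-dec ¬? (adj? a d) ×-dec ¬? (adj? b c) ×-dec ¬? (adj? b d))

  isInducedMatching? : DecidableEquality (V G) → Decidable₂ (Adj G) →
                       Decidable (IsInducedMatching G)
  isInducedMatching? _≟_ adj? M =
    all? (λ (a , b) → adj? a b) M ×-dec allPairs? (compatible? _≟_ adj?) M

  module _ {P : Pred (V G) 0ℓ} where

    forget : Edge (Induced G P) → Edge G
    forget ((a , _) , (b , _)) = a , b

    Induced-isInducedMatching : ∀ M → IsInducedMatching G (map forget M) →
                                IsInducedMatching (Induced G P) M
    Induced-isInducedMatching M (adjacent , compatible) =
      All.map⁻ adjacent , AllPairs.map lift (AllPairs.map⁻ compatible)
      where
        lift : ∀ {e f} → Compatible G (forget e) (forget f) → Compatible (Induced G P) e f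
        lift {_ , _} {_ , _} ((a≢c , a≢d , b≢c , b≢d) , nonadjacent) =
          (a≢c ∘ cong proj₁ , a≢d ∘ cong proj₁ , b≢c ∘ cong proj₁ , b≢d ∘ cong proj₁) , nonadjacent

module Orientation (G : Graph) (orient : Edge G → Edge G)
                   (orient-flips : ∀ e → orient e ≡ e ⊎ orient e ≡ swap e) where

  orient-compatible : ∀ {e f} → Compatible G e f → Compatible G (orient e) (orient f)
  orient-compatible {e} {f} c with orient e | orient-flips e | orient f | orient-flips f
  ... | _ | inj₁ refl | _ | inj₁ refl = c
  ... | _ | inj₁ refl | _ | inj₂ refl = Compatible-swapʳ G c
  ... | _ | inj₂ refl | _ | inj₁ refl = Compatible-swapˡ G c
  ... | _ | inj₂ refl | _ | inj₂ refl = Compatible-swapˡ G (Compatible-swapʳ G c)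

  module _ {P : Pred (Edge G) 0ℓ} (P-swap : ∀ e → P e → P (swap e)) where

    orient-preserves : ∀ {e} → P e → P (orient e)
    orient-preserves {e} p with orient e | orient-flips e
    ... | _ | inj₁ refl = p
    ... | _ | inj₂ refl = P-swap _ p

    orient-reflects : ∀ {e} → P (orient e) → P e
    orient-reflects {e} p with orient e | orient-flips e
    ... | _ | inj₁ refl = p
    ... | _ | inj₂ refl = P-swap _ p

    Any-map-orient⁻ : ∀ {M} → Any P (map orient M) → Any P M
    Any-map-orient⁻ = Any.map orient-reflects ∘ Any.map⁻

module _ {n m : ℕ} where

  vertex-≟ : DecidableEquality (V (Grid n m))
  vertex-≟ = ≡-dec Fin._≟_ Fin._≟_

  edge-≟ : DecidableEquality (Edge (Grid n m))
  edge-≟ = ≡-dec vertex-≟ vertex-≟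

  grid-adj? : Decidable₂ (Adj (Grid n m))
  grid-adj? (i , j) (k , l) =
    ((i Fin.≟ k) ×-dec ((toℕ j ℕ.≟ suc (toℕ l)) ⊎-dec (toℕ l ℕ.≟ suc (toℕ j)))) ⊎-dec
    ((j Fin.≟ l) ×-dec ((toℕ i ℕ.≟ suc (toℕ k)) ⊎-dec (toℕ k ℕ.≟ suc (toℕ i))))

  grid-adj-sym : Symmetric (Adj (Grid n m))
  grid-adj-sym (inj₁ (i≡k , inj₁ j≡1+l)) = inj₁ (sym i≡k , inj₂ j≡1+l)
  grid-adj-sym (inj₁ (i≡k , inj₂ l≡1+j)) = inj₁ (sym i≡k , inj₁ l≡1+j)
  grid-adj-sym (inj₂ (j≡l , inj₁ i≡1+k)) = inj₂ (sym j≡l , inj₂ i≡1+k)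
  grid-adj-sym (inj₂ (j≡l , inj₂ k≡1+i)) = inj₂ (sym j≡l , inj₁ k≡1+i)

  grid-inducedMatching? : Decidable (IsInducedMatching (Grid n m))
  grid-inducedMatching? = isInducedMatching? (Grid n m) vertex-≟ grid-adj?

  Forward : Pred (Edge (Grid n m)) 0ℓ
  Forward ((i , j) , (k , l)) = (i ≡ k × toℕ l ≡ suc (toℕ j)) ⊎ (j ≡ l × toℕ k ≡ suc (toℕ i))

  forward? : Decidable Forward
  forward? ((i , j) , (k , l)) =
    ((i Fin.≟ k) ×-dec (toℕ l ℕ.≟ suc (toℕ j))) ⊎-dec ((j Fin.≟ l) ×-dec (toℕ k ℕ.≟ suc (toℕ i)))

  adj⇒forward : ∀ {x y} → Adj (Grid n m) x y → Forward (x , y) ⊎ Forward (y , x)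
  adj⇒forward (inj₁ (i≡k , inj₁ j≡1+l)) = inj₂ (inj₁ (sym i≡k , j≡1+l))
  adj⇒forward (inj₁ (i≡k , inj₂ l≡1+j)) = inj₁ (inj₁ (i≡k , l≡1+j))
  adj⇒forward (inj₂ (j≡l , inj₁ i≡1+k)) = inj₂ (inj₂ (sym j≡l , i≡1+k))
  adj⇒forward (inj₂ (j≡l , inj₂ k≡1+i)) = inj₁ (inj₂ (j≡l , k≡1+i))

  orient : Edge (Grid n m) → Edge (Grid n m)
  orient e with forward? e
  ... | yes _ = e
  ... | no _  = swap e

  orient-flips : ∀ e → orient e ≡ e ⊎ orient e ≡ swap e
  orient-flips e with forward? e
  ... | yes _ = inj₁ refl
  ... | no _  = inj₂ refl

  orient-forward : ∀ {x y} → Adj (Grid n m) x y → Forward (orient (x , y))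
  orient-forward {x} {y} x~y with forward? (x , y) | adj⇒forward x~y
  ... | yes fwd | _ = fwd
  ... | no ¬fwd | inj₁ fwd = ⊥-elim (¬fwd fwd)
  ... | no _    | inj₂ fwd = fwd

open Orientation G55 orient orient-flips

u₁v₁u₂v₁ : Edge G55
u₁v₁u₂v₁ = uv (# 0) (# 0) , uv (# 1) (# 0)

vertices : List (V G55)
vertices = cartesianProduct (allFin 5) (allFin 5)

∈-vertices : ∀ x → x ∈ vertices
∈-vertices (i , j) = ∈-cartesianProduct⁺ (∈-allFin i) (∈-allFin j)

candidate? : Decidable (λ e → Forward e × e ≢ u₁v₁u₂v₁)
candidate? e = forward? e ×-dec ¬? (edge-≟ e u₁v₁u₂v₁)

candidates : List (Edge G55)
candidates = filter candidate? (cartesianProduct vertices vertices)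

∈-candidates : ∀ {e} → Forward e → e ≢ u₁v₁u₂v₁ → e ∈ candidates
∈-candidates {x , y} fwd e≢u₁v₁u₂v₁ =
  ∈-filter⁺ candidate? (∈-cartesianProduct⁺ (∈-vertices x) (∈-vertices y)) (fwd , e≢u₁v₁u₂v₁)

AvoidsV₁ : Pred (Edge G55) 0ℓ
AvoidsV₁ ((_ , j) , (_ , l)) = j ≢ zero × l ≢ zero

avoidsV₁? : Decidable AvoidsV₁
avoidsV₁? ((_ , j) , (_ , l)) = ¬? (j Fin.≟ zero) ×-dec ¬? (l Fin.≟ zero)

∈-Ma⁺ : ∀ {e M} → e ∈ M → AvoidsV₁ e → e ∈ Ma M
∈-Ma⁺ = ∈-filter⁺ avoidsV₁?

∈-Ma⁻ : ∀ {e} M → e ∈ Ma M → e ∈ M × AvoidsV₁ e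
∈-Ma⁻ M = ∈-filter⁻ avoidsV₁? {xs = M}

_∈ₑ?_ : ∀ x (e : Edge G55) → Dec (_∈ₑ_ {G55} x e)
x ∈ₑ? (a , b) = vertex-≟ x a ⊎-dec vertex-≟ x b

inV5? : Decidable InV5
inV5? ((_ , j) , (_ , l)) = (j Fin.≟ # 4) ×-dec (l Fin.≟ # 4)

Conclusion : Pred (List (Edge G55)) 0ℓ
Conclusion M =
  (Saturated G55 (uv (# 3) (# 0)) M ⊎ Saturated G55 (uv (# 4) (# 0)) M) ×
  Any InV5 M × length (Ma M) ≤ 4

conclusion? : Decidable Conclusion
conclusion? M =
  (any? (uv (# 3) (# 0) ∈ₑ?_) M ⊎-dec any? (uv (# 4) (# 0) ∈ₑ?_) M) ×-dec
  any? inV5? M ×-dec (length (Ma M) ≤? 4)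

open import Data.List.Membership.DecPropositional (edge-≟ {5} {5}) using (_∈?_)
open CliqueSearch edge-≟ (compatible? G55 vertex-≟ grid-adj?) 6 conclusion?

candidateClique⇒Conclusion : ∀ {ys} → ys ⊑ candidates →
                             Clique (Compatible G55) (ys ʳ++ [ u₁v₁u₂v₁ ]) →
                             6 ≤ length (ys ʳ++ [ u₁v₁u₂v₁ ]) → Conclusion (ys ʳ++ [ u₁v₁u₂v₁ ])
candidateClique⇒Conclusion = search-sound [ u₁v₁u₂v₁ ] candidates _

Conclusion-⊆ : ∀ {xs ys} → Unique xs → xs ⊆ ys → ys ⊆ xs → Conclusion ys → Conclusion xs
Conclusion-⊆ xs! xs⊆ys ys⊆xs (saturates , inV5 , few) =
  Sum.map (Any-resp-⊆ ys⊆xs) (Any-resp-⊆ ys⊆xs) saturates ,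
  Any-resp-⊆ ys⊆xs inV5 ,
  ≤-trans (Unique-⊆⇒length≤ (Unique.filter⁺ avoidsV₁? xs!) (filter⁺′ avoidsV₁? avoidsV₁? id xs⊆ys))
          few

forwardClique⇒Conclusion : ∀ K → Unique K → All Forward K → u₁v₁u₂v₁ ∈ K →
                           Clique (Compatible G55) K → 6 ≤ length K → Conclusion K
forwardClique⇒Conclusion K K! K-forward u₁v₁u₂v₁∈K clique six≤ =
  Conclusion-⊆ K! K⊆L L⊆K
    (candidateClique⇒Conclusion (Sublist.filter-⊆ (_∈? K) candidates)
                  (Clique-⊆ L⊆K clique) (≤-trans six≤ (Unique-⊆⇒length≤ K! K⊆L)))
  where
    K-candidates : List (Edge G55)
    K-candidates = filter (_∈? K) candidates

    L : List (Edge G55)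
    L = K-candidates ʳ++ [ u₁v₁u₂v₁ ]

    L⊆K : L ⊆ K
    L⊆K e∈L with Any.reverseAcc⁻ [ u₁v₁u₂v₁ ] K-candidates e∈L
    ... | inj₁ (here refl) = u₁v₁u₂v₁∈K
    ... | inj₂ e∈K-candidates = proj₂ (∈-filter⁻ (_∈? K) e∈K-candidates)

    K⊆L : K ⊆ L
    K⊆L {e} e∈K with edge-≟ e u₁v₁u₂v₁
    ... | yes refl = Any.reverseAcc⁺ [ u₁v₁u₂v₁ ] K-candidates (inj₁ (here refl))
    ... | no e≢u₁v₁u₂v₁ = Any.reverseAcc⁺ [ u₁v₁u₂v₁ ] K-candidates (inj₂
      (∈-filter⁺ (_∈? K) (∈-candidates (All.lookup K-forward e∈K) e≢u₁v₁u₂v₁) e∈K))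

InV5-swap : ∀ e → InV5 e → InV5 (swap e)
InV5-swap (_ , _) = swap

AvoidsV₁-swap : ∀ e → AvoidsV₁ e → AvoidsV₁ (swap e)
AvoidsV₁-swap (_ , _) = swap

Conclusion-map-orient⁻ : ∀ {M} → AllPairs (Compatible G55) M →
                         Conclusion (map orient M) → Conclusion M
Conclusion-map-orient⁻ {M} compatible (saturates , inV5 , few) =
  Sum.map (Any-map-orient⁻ (λ _ → Sum.swap)) (Any-map-orient⁻ (λ _ → Sum.swap)) saturates ,
  Any-map-orient⁻ {P = InV5} InV5-swap inV5 ,
  ≤-trans avoiding-bound few
  where
    avoiding-bound : length (Ma M) ≤ length (Ma (map orient M))
    avoiding-bound = begin
      length (Ma M)                 ≡⟨ sym (length-map orient (Ma M)) ⟩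
      length (map orient (Ma M))    ≤⟨ Unique-⊆⇒length≤ oriented-unique oriented-⊆ ⟩
      length (Ma (map orient M))    ∎
      where
        open ≤-Reasoning
        oriented-unique : Unique (map orient (Ma M))
        oriented-unique = AllPairs.map⁺ (AllPairs.map (Compatible⇒≢ G55 ∘ orient-compatible)
                                                      (AllPairs.filter⁺ avoidsV₁? compatible))
        oriented-⊆ : map orient (Ma M) ⊆ Ma (map orient M)
        oriented-⊆ e∈ with ∈-map⁻ orient e∈
        ... | f , f∈Ma , refl with ∈-Ma⁻ M f∈Ma
        ...   | f∈M , f-avoids = ∈-Ma⁺ (∈-map⁺ orient f∈M)
                                   (orient-preserves {P = AvoidsV₁} AvoidsV₁-swap {f} f-avoids)

six-edge-matching : List (Edge G55)
six-edge-matching =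
  (uv (# 0) (# 0) , uv (# 1) (# 0)) ∷ (uv (# 0) (# 2) , uv (# 1) (# 2)) ∷
  (uv (# 0) (# 4) , uv (# 1) (# 4)) ∷ (uv (# 3) (# 0) , uv (# 4) (# 0)) ∷
  (uv (# 3) (# 2) , uv (# 4) (# 2)) ∷ (uv (# 3) (# 4) , uv (# 4) (# 4)) ∷ []

six-edge-matching-induced : IsInducedMatching G55 six-edge-matching
six-edge-matching-induced = toWitness {a? = grid-inducedMatching? six-edge-matching} _

five-edge-matching : List (Edge Ga)
five-edge-matching =
  (((# 0 , # 1) , λ ()) , ((# 1 , # 1) , λ ())) ∷
  (((# 0 , # 3) , λ ()) , ((# 0 , # 4) , λ ())) ∷
  (((# 2 , # 2) , λ ()) , ((# 2 , # 3) , λ ())) ∷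
  (((# 3 , # 1) , λ ()) , ((# 4 , # 1) , λ ())) ∷
  (((# 3 , # 4) , λ ()) , ((# 4 , # 4) , λ ())) ∷ []

five-edge-matching-induced : IsInducedMatching Ga five-edge-matching
five-edge-matching-induced =
  Induced-isInducedMatching G55 five-edge-matching
    (toWitness {a? = grid-inducedMatching? (map (forget G55) five-edge-matching)} _)

inducedMatching⇒Conclusion : ∀ {M} → IsInducedMatching G55 M →
                             EdgeIn G55 (uv (# 0) (# 0)) (uv (# 1) (# 0)) M → 6 ≤ length M →
                             Conclusion M
inducedMatching⇒Conclusion {M} (adjacent , compatible) u₁v₁u₂v₁∈M six≤ =
  Conclusion-map-orient⁻ compatible
    (forwardClique⇒Conclusion K (AllPairs.map (Compatible⇒≢ G55) K-compatible)
      (All.map⁺ (All.map orient-forward adjacent)) u₁v₁u₂v₁∈K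
      (AllPairs⇒Clique (Compatible-sym G55 grid-adj-sym) K-compatible)
      (subst (6 ≤_) (sym (length-map orient M)) six≤))
  where
    K : List (Edge G55)
    K = map orient M

    K-compatible : AllPairs (Compatible G55) K
    K-compatible = AllPairs.map⁺ (AllPairs.map orient-compatible compatible)

    -- orient computes u₁v₁u₂v₁ from either orientation of the edge.
    u₁v₁u₂v₁∈K : u₁v₁u₂v₁ ∈ K
    u₁v₁u₂v₁∈K = Sum.[ ∈-map⁺ orient , ∈-map⁺ orient ]′ u₁v₁u₂v₁∈M

Max-Ga-≥5 : ∀ {k} → IsMax Ga k → 5 ≤ k
Max-Ga-≥5 (_ , maximum) = maximum five-edge-matching five-edge-matching-induced

lemma3p12 : (M : List (Edge G55)) → IsMaximumInducedMatching G55 M →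
    EdgeIn G55 (uv zero zero) (uv (suc zero) zero) M →
      (Saturated G55 (uv (suc (suc (suc zero))) zero) M ⊎ Saturated G55 (uv (suc (suc (suc (suc zero)))) zero) M)
      × ((k : ℕ) → IsMax Ga k → length (Ma M) ≢ k)
      × Any InV5 M
lemma3p12 M (induced , maximum) u₁v₁u₂v₁∈M =
  let saturates , inV5 , few = inducedMatching⇒Conclusion induced u₁v₁u₂v₁∈M
                                 (maximum six-edge-matching six-edge-matching-induced)
  in saturates , (λ k k-max → <⇒≢ (≤-trans (s≤s few) (Max-Ga-≥5 k-max))) , inV5
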